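{- Let $A\in GL_n(\mathbb{F}_q)$. Then $$\mathrm{Im}(\partial\mathrm{char}_A)=\left\{\frac{\mathrm{char}(A)}{\min(A)}\,a:\ a\in\mathbb{F}_q[x],\ \deg a<\deg\min(A)\right\}.$$
   Context: $q$ is a power of an odd prime. $\mathrm{char}(A)=\det(xI-A)$ and $\min(A)$ is the minimal polynomial of $A$. $\partial\mathrm{char}_A:M_n(\mathbb{F}_q)\to\mathbb{F}_q[x]$ is the $\mathbb{F}_q$-linear map $A_1\mapsto\mathrm{tr}\big(\mathrm{Adj}(xI-A)\,A\,A_1\big)$, with $\mathrm{Adj}$ the adjugate matrix. -}

module Defs where

open import Level using (_⊔_)
open import Algebra.Bundles using (CommutativeRing)
open import Data.Nat using (ℕ; zero; suc; _≤_; _∸_) renaming (_+_ to _+ℕ_)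
open import Data.Fin using (Fin; zero; suc; punchIn; toℕ; _≟_)
open import Data.Bool using (if_then_else_)
open import Data.Product using (Σ; ∃; _×_)
open import Relation.Nullary using (¬_; does)
open import Relation.Binary.PropositionalEquality using (_≡_)

module MatOps {a} (A : Set a) (0# 1# : A) (_+_ _*_ : A → A → A) (-_ : A → A) where

  Mat : ℕ → Set a
  Mat n = Fin n → Fin n → A

  ΣF : ∀ n → (Fin n → A) → A
  ΣF zero    f = 0#
  ΣF (suc n) f = f zero + ΣF n (λ i → f (suc i))

  alt : ℕ → A → A
  alt zero    x = x
  alt (suc k) x = - alt k x

  idM : ∀ {n} → Mat n
  idM i j = if does (i ≟ j) then 1# else 0#

  _·M_ : ∀ {n} → Mat n → Mat n → Mat n
  _·M_ {n} M N i j = ΣF n (λ k → M i k * N k j)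

  _+M_ : ∀ {n} → Mat n → Mat n → Mat n
  (M +M N) i j = M i j + N i j

  -M_ : ∀ {n} → Mat n → Mat n
  (-M M) i j = - M i j

  _∙M_ : ∀ {n} → A → Mat n → Mat n
  (c ∙M M) i j = c * M i j

  zeroM : ∀ {n} → Mat n
  zeroM i j = 0#

  _^M_ : ∀ {n} → Mat n → ℕ → Mat n
  M ^M zero  = idM
  M ^M suc k = M ·M (M ^M k)

  trace : ∀ {n} → Mat n → A
  trace {n} M = ΣF n (λ i → M i i)

  minor : ∀ {n} → Fin (suc n) → Fin (suc n) → Mat (suc n) → Mat n
  minor i j M r c = M (punchIn i r) (punchIn j c)

  det : ∀ n → Mat n → A
  det zero    M = 1#
  det (suc n) M = ΣF (suc n) (λ j → alt (toℕ j) (M zero j * det n (minor zero j M)))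

  adj : ∀ n → Mat n → Mat n
  adj (suc n) M i j = alt (toℕ i +ℕ toℕ j) (det n (minor j i M))

module Over {c ℓ} (F : CommutativeRing c ℓ) where
  open CommutativeRing F using (Carrier; _≈_; 0#; 1#; _+_; _*_; -_)

  module FM = MatOps Carrier 0# 1# _+_ _*_ (-_)
  open FM public using (Mat)

  _≈M_ : ∀ {n} → Mat n → Mat n → Set ℓ
  M ≈M N = ∀ i j → M i j ≈ N i j

  Invertible : ∀ {n} → Mat n → Set (c ⊔ ℓ)
  Invertible A = Σ (Mat _) λ B → (A FM.·M B) ≈M FM.idM × (B FM.·M A) ≈M FM.idM

  -- Polynomials in F[x] are represented inside F[[x]] by their coefficient
  -- sequences; equality is coefficientwise.
  PS : Set c
  PS = ℕ → Carrier

  _≈ₚ_ : PS → PS → Set ℓ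
  f ≈ₚ g = ∀ k → f k ≈ g k

  0ₚ 1ₚ X : PS
  0ₚ k = 0#
  1ₚ zero = 1#
  1ₚ (suc k) = 0#
  X zero = 0#
  X (suc zero) = 1#
  X (suc (suc k)) = 0#

  const : Carrier → PS
  const a zero = a
  const a (suc k) = 0#

  _+ₚ_ : PS → PS → PS
  (f +ₚ g) k = f k + g k

  -ₚ_ : PS → PS
  (-ₚ f) k = - f k

  sumTo : (ℕ → Carrier) → ℕ → Carrier
  sumTo f zero    = 0#
  sumTo f (suc n) = sumTo f n + f n

  _*ₚ_ : PS → PS → PS
  (f *ₚ g) k = sumTo (λ i → f i * g (k ∸ i)) (suc k)

  DegLt : ℕ → PS → Set ℓ
  DegLt d p = ∀ k → d ≤ k → p k ≈ 0#

  MonicDeg : ℕ → PS → Set ℓ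
  MonicDeg d p = (p d ≈ 1#) × DegLt (suc d) p

  module PM = MatOps PS 0ₚ 1ₚ _+ₚ_ _*ₚ_ -ₚ_

  liftM : ∀ {n} → Mat n → PM.Mat n
  liftM A i j = const (A i j)

  xI-A : ∀ {n} → Mat n → PM.Mat n
  xI-A A = (X PM.∙M PM.idM) PM.+M (PM.-M liftM A)

  char : ∀ {n} → Mat n → PS
  char {n} A = PM.det n (xI-A A)

  -- p(A) for p of degree ≤ d
  evalM : ∀ {n} → ℕ → PS → Mat n → Mat n
  evalM zero    p A = p zero FM.∙M FM.idM
  evalM (suc d) p A = evalM d p A FM.+M (p (suc d) FM.∙M (A FM.^M suc d))

  IsMinPoly : ∀ {n} → Mat n → ℕ → PS → Set (c ⊔ ℓ)
  IsMinPoly A d m =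
    MonicDeg d m × (evalM d m A ≈M FM.zeroM) ×
    (∀ e p → MonicDeg e p → evalM e p A ≈M FM.zeroM → d ≤ e)

  ∂char : ∀ {n} → Mat n → Mat n → PS
  ∂char {n} A A₁ = PM.trace ((PM.adj n (xI-A A) PM.·M liftM A) PM.·M liftM A₁)

  record IsFiniteField (q : ℕ) : Set (c ⊔ ℓ) where
    field
      1≉0     : ¬ (1# ≈ 0#)
      inverse : ∀ x → ¬ (x ≈ 0#) → ∃ λ y → x * y ≈ 1#
      enum    : Fin q → Carrier
      enum-surj : ∀ x → ∃ λ i → enum i ≈ x
      enum-inj  : ∀ i j → enum i ≈ enum j → i ≡ j

-- Let M = xI - A over F[[x]] and Q(x) = (m(x) I - m(A)) / (x - A), whose coefficients Qₜ
-- come from Horner's scheme for m(A). Then M Q = m I, so M adj(M) = char(A) I = h m I = M (h Q);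
-- as A is invertible, M cancels on matrices of power series and adj(M) = h Q. Hence
-- ∂char_A(A₁) = h a with aₜ = tr(Qₜ A A₁), and deg a < d = deg m because Qₜ = 0 for t ≥ d.
-- Conversely, a linear relation among the Qₜ A (t < d) would give a nonzero polynomial of
-- degree < d annihilating A, so they are independent; the trace form being nondegenerate, they
-- have a dual family, and every a of degree < d is reached by a combination of it.

module Submission where

open import Defs
open import Algebra.Bundles using (CommutativeRing)
open import Data.Nat using (ℕ; _^_; _≤_)
open import Data.Nat.Primality using (Prime)
open import Data.Nat.Divisibility using (_∣_)
open import Data.Product using (∃; _×_)
open import Relation.Nullary using (¬_)
open import Relation.Binary.PropositionalEquality using (_≡_)

import Algebra.Construct.Pointwise as Pointwise
import Algebra.Properties.CommutativeSemigroup as CommSemigroupProperties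
open import Data.Bool using (true; false; if_then_else_)
open import Data.Empty using (⊥-elim)
open import Data.Fin using (Fin; zero; suc; punchIn; punchOut; toℕ; fromℕ<; _≟_)
import Data.Fin.Properties as Fin
open import Data.Nat using (zero; suc; _<_; _∸_; z≤n; s≤s; s≤s⁻¹) renaming (_+_ to _+ℕ_)
import Data.Nat.Properties as ℕ
open import Data.Product using (Σ; _,_; proj₁; proj₂)
open import Data.Vec.Functional using (_∷_)
open import Function using (_∘′_)
open import Level using (_⊔_)
open import Relation.Binary.Bundles using (Setoid)
open import Relation.Binary.Definitions using (Decidable; tri<; tri≈; tri>)
open import Relation.Binary.PropositionalEquality using (_≢_; cong)
import Relation.Binary.PropositionalEquality as ≡
import Relation.Binary.Reasoning.Setoid as SetoidReasoning
open import Relation.Nullary using (yes; no; does)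

module Matrices {c ℓ} (R : CommutativeRing c ℓ) where
  open CommutativeRing R hiding (zero)
  open MatOps Carrier 0# 1# _+_ _*_ -_ public
  open import Algebra.Properties.Ring ring public
    using (-‿distribˡ-*; -‿distribʳ-*; -‿involutive; -‿anti-homo-+; -0#≈0#;
           x≈y⇒x∙y⁻¹≈ε; x≈z//y; +-cancelˡ)
  open CommSemigroupProperties +-commutativeSemigroup public
    using () renaming (interchange to +-interchange; x∙yz≈y∙xz to x+[y+z]≈y+[x+z])
  open CommSemigroupProperties *-commutativeSemigroup public
    using () renaming (x∙yz≈y∙xz to x*[y*z]≈y*[x*z])
  open import Relation.Binary.Reasoning.Setoid setoid

  ΣF-cong : ∀ n {f g : Fin n → Carrier} → (∀ i → f i ≈ g i) → ΣF n f ≈ ΣF n g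
  ΣF-cong zero    f≈g = refl
  ΣF-cong (suc n) f≈g = +-cong (f≈g zero) (ΣF-cong n (λ i → f≈g (suc i)))

  ΣF-zero : ∀ n {f : Fin n → Carrier} → (∀ i → f i ≈ 0#) → ΣF n f ≈ 0#
  ΣF-zero zero    f≈0 = refl
  ΣF-zero (suc n) f≈0 = trans (+-cong (f≈0 zero) (ΣF-zero n (λ i → f≈0 (suc i)))) (+-identityˡ 0#)

  ΣF-distrib-+ : ∀ n (f g : Fin n → Carrier) → ΣF n (λ i → f i + g i) ≈ ΣF n f + ΣF n g
  ΣF-distrib-+ zero    f g = sym (+-identityˡ 0#)
  ΣF-distrib-+ (suc n) f g =
    trans (+-congˡ (ΣF-distrib-+ n _ _)) (+-interchange _ _ _ _)

  *-distribˡ-ΣF : ∀ n x (f : Fin n → Carrier) → x * ΣF n f ≈ ΣF n (λ i → x * f i)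
  *-distribˡ-ΣF zero    x f = zeroʳ x
  *-distribˡ-ΣF (suc n) x f = trans (distribˡ _ _ _) (+-congˡ (*-distribˡ-ΣF n x _))

  *-distribʳ-ΣF : ∀ n x (f : Fin n → Carrier) → ΣF n f * x ≈ ΣF n (λ i → f i * x)
  *-distribʳ-ΣF n x f =
    trans (*-comm _ _) (trans (*-distribˡ-ΣF n x f) (ΣF-cong n (λ i → *-comm _ _)))

  -‿distrib-ΣF : ∀ n (f : Fin n → Carrier) → - ΣF n f ≈ ΣF n (λ i → - f i)
  -‿distrib-ΣF zero    f = -0#≈0#
  -‿distrib-ΣF (suc n) f =
    trans (-‿anti-homo-+ _ _) (trans (+-comm _ _) (+-congˡ (-‿distrib-ΣF n _)))

  ΣF-comm : ∀ n m (f : Fin n → Fin m → Carrier) →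
            ΣF n (λ i → ΣF m (f i)) ≈ ΣF m (λ j → ΣF n (λ i → f i j))
  ΣF-comm zero    m f = sym (ΣF-zero m (λ _ → refl))
  ΣF-comm (suc n) m f = trans (+-congˡ (ΣF-comm n m _)) (sym (ΣF-distrib-+ m _ _))

  ΣF-remove : ∀ n (a : Fin (suc n)) (f : Fin (suc n) → Carrier) →
              ΣF (suc n) f ≈ f a + ΣF n (λ l → f (punchIn a l))
  ΣF-remove n       zero    f = refl
  ΣF-remove (suc n) (suc a) f =
    trans (+-congˡ (ΣF-remove n a (λ i → f (suc i)))) (x+[y+z]≈y+[x+z] _ _ _)

  ΣF-single : ∀ n (a : Fin n) (f : Fin n → Carrier) → (∀ i → i ≢ a → f i ≈ 0#) →
              ΣF n f ≈ f a
  ΣF-single (suc n) a f f≈0 = begin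
    ΣF (suc n) f                          ≈⟨ ΣF-remove n a f ⟩
    f a + ΣF n (λ l → f (punchIn a l))    ≈⟨ +-congˡ (ΣF-zero n (λ l → f≈0 _ (Fin.punchInᵢ≢i a l))) ⟩
    f a + 0#                              ≈⟨ +-identityʳ _ ⟩
    f a                                   ∎

  idM-diagonal : ∀ {n} (i : Fin n) → idM i i ≈ 1#
  idM-diagonal zero    = refl
  idM-diagonal (suc i) = idM-diagonal i

  idM-offDiagonal : ∀ {n} {i j : Fin n} → i ≢ j → idM i j ≈ 0#
  idM-offDiagonal {i = zero}  {zero}  i≢j = ⊥-elim (i≢j ≡.refl)
  idM-offDiagonal {i = zero}  {suc j} i≢j = refl
  idM-offDiagonal {i = suc i} {zero}  i≢j = refl
  idM-offDiagonal {i = suc i} {suc j} i≢j = idM-offDiagonal (i≢j ∘′ cong suc)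

  idM-sym : ∀ {n} (i j : Fin n) → idM i j ≡ idM j i
  idM-sym zero    zero    = ≡.refl
  idM-sym zero    (suc j) = ≡.refl
  idM-sym (suc i) zero    = ≡.refl
  idM-sym (suc i) (suc j) = idM-sym i j

  ΣF-idMˡ : ∀ n (i : Fin n) (f : Fin n → Carrier) → ΣF n (λ k → idM i k * f k) ≈ f i
  ΣF-idMˡ n i f = trans
    (ΣF-single n i _ (λ k k≢i → trans (*-congʳ (idM-offDiagonal (k≢i ∘′ ≡.sym))) (zeroˡ _)))
    (trans (*-congʳ (idM-diagonal i)) (*-identityˡ _))

  ΣF-idMʳ : ∀ n (i : Fin n) (f : Fin n → Carrier) → ΣF n (λ k → f k * idM k i) ≈ f i
  ΣF-idMʳ n i f = trans (ΣF-cong n (λ k → trans (*-comm _ _) (*-congʳ (reflexive (idM-sym k i)))))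
                        (ΣF-idMˡ n i f)

  alt-cong : ∀ k {x y} → x ≈ y → alt k x ≈ alt k y
  alt-cong zero    x≈y = x≈y
  alt-cong (suc k) x≈y = -‿cong (alt-cong k x≈y)

  alt-+ : ∀ a b x → alt (a +ℕ b) x ≈ alt a (alt b x)
  alt-+ zero    b x = refl
  alt-+ (suc a) b x = -‿cong (alt-+ a b x)

  alt-≡ : ∀ {a b} x → a ≡ b → alt a x ≈ alt b x
  alt-≡ x ≡.refl = refl

  alt-suc-suc : ∀ a x → alt (suc (suc a)) x ≈ alt a x
  alt-suc-suc a x = -‿involutive _

  alt-zero : ∀ a {x} → x ≈ 0# → alt a x ≈ 0#
  alt-zero zero    x≈0 = x≈0
  alt-zero (suc a) x≈0 = trans (-‿cong (alt-zero a x≈0)) -0#≈0#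

  *-alt : ∀ a x y → x * alt a y ≈ alt a (x * y)
  *-alt zero    x y = refl
  *-alt (suc a) x y = trans (sym (-‿distribʳ-* _ _)) (-‿cong (*-alt a x y))

  alt-ΣF : ∀ a n (f : Fin n → Carrier) → alt a (ΣF n f) ≈ ΣF n (λ i → alt a (f i))
  alt-ΣF zero    n f = refl
  alt-ΣF (suc a) n f = trans (-‿cong (alt-ΣF a n f)) (-‿distrib-ΣF n _)

  alt-*-ΣF : ∀ a x n (s : Fin n → ℕ) (f : Fin n → Carrier) →
             alt a (x * ΣF n (λ l → alt (s l) (f l))) ≈ ΣF n (λ l → alt (a +ℕ s l) (x * f l))
  alt-*-ΣF a x n s f = begin
    alt a (x * ΣF n (λ l → alt (s l) (f l)))   ≈⟨ alt-cong a (*-distribˡ-ΣF n x _) ⟩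
    alt a (ΣF n (λ l → x * alt (s l) (f l)))   ≈⟨ alt-ΣF a n _ ⟩
    ΣF n (λ l → alt a (x * alt (s l) (f l)))   ≈⟨ ΣF-cong n (λ l → alt-cong a (*-alt (s l) x (f l))) ⟩
    ΣF n (λ l → alt a (alt (s l) (x * f l)))   ≈⟨ ΣF-cong n (λ l → alt-+ a (s l) _) ⟨
    ΣF n (λ l → alt (a +ℕ s l) (x * f l))      ∎

  infix 4 _≋_
  _≋_ : ∀ {n} → Mat n → Mat n → Set ℓ
  M ≋ N = ∀ i j → M i j ≈ N i j

  ≋-setoid : ℕ → Setoid c ℓ
  ≋-setoid n = record
    { Carrier       = Mat n
    ; _≈_           = _≋_
    ; isEquivalence = record
      { refl  = λ i j → refl
      ; sym   = λ M≋N i j → sym (M≋N i j)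
      ; trans = λ M≋N N≋O i j → trans (M≋N i j) (N≋O i j)
      }
    }

  module ≋-Reasoning {n} = SetoidReasoning (≋-setoid n)

  ≋-refl : ∀ {n} {M : Mat n} → M ≋ M
  ≋-refl i j = refl

  ≋-sym : ∀ {n} {M N : Mat n} → M ≋ N → N ≋ M
  ≋-sym M≋N i j = sym (M≋N i j)

  ≋-trans : ∀ {n} {M N O : Mat n} → M ≋ N → N ≋ O → M ≋ O
  ≋-trans M≋N N≋O i j = trans (M≋N i j) (N≋O i j)

  +M-cong : ∀ {n} {M M′ N N′ : Mat n} → M ≋ M′ → N ≋ N′ → (M +M N) ≋ (M′ +M N′)
  +M-cong M≋M′ N≋N′ i j = +-cong (M≋M′ i j) (N≋N′ i j)

  +M-assoc : ∀ {n} (L M N : Mat n) → ((L +M M) +M N) ≋ (L +M (M +M N))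
  +M-assoc L M N i j = +-assoc _ _ _

  +M-identityʳ : ∀ {n} (M : Mat n) → (M +M zeroM) ≋ M
  +M-identityʳ M i j = +-identityʳ _

  ∙-cong : ∀ {n} {x y} {M N : Mat n} → x ≈ y → M ≋ N → (x ∙M M) ≋ (y ∙M N)
  ∙-cong x≈y M≋N i j = *-cong x≈y (M≋N i j)

  ∙-assoc : ∀ {n} x y (M : Mat n) → ((x * y) ∙M M) ≋ (x ∙M (y ∙M M))
  ∙-assoc x y M i j = *-assoc _ _ _

  ∙-zeroˡ : ∀ {n} {x} (M : Mat n) → x ≈ 0# → (x ∙M M) ≋ zeroM
  ∙-zeroˡ M x≈0 i j = trans (*-congʳ x≈0) (zeroˡ _)

  ∙-zeroʳ : ∀ {n} x {M : Mat n} → M ≋ zeroM → (x ∙M M) ≋ zeroM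
  ∙-zeroʳ x M≋0 i j = trans (*-congˡ (M≋0 i j)) (zeroʳ _)

  ·-cong : ∀ {n} {M M′ N N′ : Mat n} → M ≋ M′ → N ≋ N′ → (M ·M N) ≋ (M′ ·M N′)
  ·-cong {n} M≋M′ N≋N′ i j = ΣF-cong n (λ k → *-cong (M≋M′ i k) (N≋N′ k j))

  ·-assoc : ∀ {n} (L M N : Mat n) → ((L ·M M) ·M N) ≋ (L ·M (M ·M N))
  ·-assoc {n} L M N i j = begin
    ΣF n (λ k → ΣF n (λ l → L i l * M l k) * N k j)
      ≈⟨ ΣF-cong n (λ k → *-distribʳ-ΣF n _ _) ⟩
    ΣF n (λ k → ΣF n (λ l → L i l * M l k * N k j))
      ≈⟨ ΣF-comm n n _ ⟩
    ΣF n (λ l → ΣF n (λ k → L i l * M l k * N k j))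
      ≈⟨ ΣF-cong n (λ l → ΣF-cong n (λ k → *-assoc _ _ _)) ⟩
    ΣF n (λ l → ΣF n (λ k → L i l * (M l k * N k j)))
      ≈⟨ ΣF-cong n (λ l → *-distribˡ-ΣF n _ _) ⟨
    ΣF n (λ l → L i l * ΣF n (λ k → M l k * N k j)) ∎

  ·-identityˡ : ∀ {n} (M : Mat n) → (idM ·M M) ≋ M
  ·-identityˡ {n} M i j = ΣF-idMˡ n i (λ k → M k j)

  ·-identityʳ : ∀ {n} (M : Mat n) → (M ·M idM) ≋ M
  ·-identityʳ {n} M i j = ΣF-idMʳ n j (λ k → M i k)

  ·-zeroˡ : ∀ {n} (M : Mat n) → (zeroM ·M M) ≋ zeroM
  ·-zeroˡ {n} M i j = ΣF-zero n (λ k → zeroˡ _)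

  ·-distribˡ : ∀ {n} (L M N : Mat n) → (L ·M (M +M N)) ≋ ((L ·M M) +M (L ·M N))
  ·-distribˡ {n} L M N i j = trans (ΣF-cong n (λ k → distribˡ _ _ _)) (ΣF-distrib-+ n _ _)

  ·-distribʳ : ∀ {n} (L M N : Mat n) → ((M +M N) ·M L) ≋ ((M ·M L) +M (N ·M L))
  ·-distribʳ {n} L M N i j = trans (ΣF-cong n (λ k → distribʳ _ _ _)) (ΣF-distrib-+ n _ _)

  ·-negˡ : ∀ {n} (M N : Mat n) → ((-M M) ·M N) ≋ (-M (M ·M N))
  ·-negˡ {n} M N i j = trans (ΣF-cong n (λ k → sym (-‿distribˡ-* _ _))) (sym (-‿distrib-ΣF n _))

  ·-negʳ : ∀ {n} (M N : Mat n) → (M ·M (-M N)) ≋ (-M (M ·M N))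
  ·-negʳ {n} M N i j = trans (ΣF-cong n (λ k → sym (-‿distribʳ-* _ _))) (sym (-‿distrib-ΣF n _))

  ·-∙ˡ : ∀ {n} x (M N : Mat n) → ((x ∙M M) ·M N) ≋ (x ∙M (M ·M N))
  ·-∙ˡ {n} x M N i j = trans (ΣF-cong n (λ k → *-assoc _ _ _)) (sym (*-distribˡ-ΣF n _ _))

  ·-∙ʳ : ∀ {n} x (M N : Mat n) → (M ·M (x ∙M N)) ≋ (x ∙M (M ·M N))
  ·-∙ʳ {n} x M N i j = trans (ΣF-cong n (λ k → x*[y*z]≈y*[x*z] _ _ _)) (sym (*-distribˡ-ΣF n _ _))

  ·-cancelˡ : ∀ {n} {A B M N : Mat n} → (B ·M A) ≋ idM → (A ·M M) ≋ (A ·M N) → M ≋ N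
  ·-cancelˡ {A = A} {B} {M} {N} BA≋I AM≋AN =
    ≋-trans (≋-sym (·-identityˡ M)) (≋-trans (·-cong (≋-sym BA≋I) ≋-refl)
      (≋-trans (·-assoc B A M) (≋-trans (·-cong ≋-refl AM≋AN)
        (≋-trans (≋-sym (·-assoc B A N)) (≋-trans (·-cong BA≋I ≋-refl) (·-identityˡ N))))))

  ·-cancelʳ : ∀ {n} {A B M N : Mat n} → (A ·M B) ≋ idM → (M ·M A) ≋ (N ·M A) → M ≋ N
  ·-cancelʳ {A = A} {B} {M} {N} AB≋I MA≋NA =
    ≋-trans (≋-sym (·-identityʳ M)) (≋-trans (·-cong ≋-refl (≋-sym AB≋I))
      (≋-trans (≋-sym (·-assoc M A B)) (≋-trans (·-cong MA≋NA ≋-refl)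
        (≋-trans (·-assoc N A B) (≋-trans (·-cong ≋-refl AB≋I) (·-identityʳ N))))))

  trace-cong : ∀ {n} {M N : Mat n} → M ≋ N → trace M ≈ trace N
  trace-cong {n} M≋N = ΣF-cong n (λ i → M≋N i i)

  trace-∙ : ∀ {n} x (M : Mat n) → trace (x ∙M M) ≈ x * trace M
  trace-∙ {n} x M = sym (*-distribˡ-ΣF n x _)

  trace-zero : ∀ {n} {M : Mat n} → M ≋ zeroM → trace M ≈ 0#
  trace-zero {n} M≋0 = ΣF-zero n (λ i → M≋0 i i)

  lincomb : ∀ {n k} → (Fin k → Carrier) → (Fin k → Mat n) → Mat n
  lincomb {k = k} cs V i j = ΣF k (λ t → cs t * V t i j)

  ·-distribˡ-lincomb : ∀ {n k} (M : Mat n) (cs : Fin k → Carrier) (V : Fin k → Mat n) →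
                       (M ·M lincomb cs V) ≋ lincomb cs (λ t → M ·M V t)
  ·-distribˡ-lincomb {n} {k} M cs V i j = begin
    ΣF n (λ l → M i l * ΣF k (λ t → cs t * V t l j))
      ≈⟨ ΣF-cong n (λ l → *-distribˡ-ΣF k _ _) ⟩
    ΣF n (λ l → ΣF k (λ t → M i l * (cs t * V t l j)))
      ≈⟨ ΣF-comm n k _ ⟩
    ΣF k (λ t → ΣF n (λ l → M i l * (cs t * V t l j)))
      ≈⟨ ΣF-cong k (λ t → ΣF-cong n (λ l → x*[y*z]≈y*[x*z] _ _ _)) ⟩
    ΣF k (λ t → ΣF n (λ l → cs t * (M i l * V t l j)))
      ≈⟨ ΣF-cong k (λ t → *-distribˡ-ΣF n _ _) ⟨
    ΣF k (λ t → cs t * ΣF n (λ l → M i l * V t l j)) ∎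

  ·-distribʳ-lincomb : ∀ {n k} (cs : Fin k → Carrier) (V : Fin k → Mat n) (M : Mat n) →
                       (lincomb cs V ·M M) ≋ lincomb cs (λ t → V t ·M M)
  ·-distribʳ-lincomb {n} {k} cs V M i j = begin
    ΣF n (λ l → ΣF k (λ t → cs t * V t i l) * M l j)
      ≈⟨ ΣF-cong n (λ l → *-distribʳ-ΣF k _ _) ⟩
    ΣF n (λ l → ΣF k (λ t → cs t * V t i l * M l j))
      ≈⟨ ΣF-comm n k _ ⟩
    ΣF k (λ t → ΣF n (λ l → cs t * V t i l * M l j))
      ≈⟨ ΣF-cong k (λ t → ΣF-cong n (λ l → *-assoc _ _ _)) ⟩
    ΣF k (λ t → ΣF n (λ l → cs t * (V t i l * M l j)))
      ≈⟨ ΣF-cong k (λ t → *-distribˡ-ΣF n _ _) ⟨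
    ΣF k (λ t → cs t * ΣF n (λ l → V t i l * M l j)) ∎

  trace-lincomb : ∀ {n k} (cs : Fin k → Carrier) (V : Fin k → Mat n) →
                  trace (lincomb cs V) ≈ ΣF k (λ t → cs t * trace (V t))
  trace-lincomb {n} {k} cs V =
    trans (ΣF-comm n k _) (ΣF-cong k (λ t → sym (*-distribˡ-ΣF n (cs t) _)))

module Determinants {c ℓ} (R : CommutativeRing c ℓ) where
  open CommutativeRing R hiding (zero)
  open Matrices R
  open import Relation.Binary.Reasoning.Setoid setoid
  open CommSemigroupProperties ℕ.+-commutativeSemigroup using ()
    renaming (x∙yz≈y∙xz to x+[y+z]≡y+[x+z])

  det-cong : ∀ n {M N : Mat n} → M ≋ N → det n M ≈ det n N
  det-cong zero    M≋N = refl
  det-cong (suc n) M≋N = ΣF-cong (suc n) (λ j → alt-cong (toℕ j)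
    (*-cong (M≋N zero j) (det-cong n (λ r c → M≋N (punchIn zero r) (punchIn j c)))))

  -- A total punchOut; its value on the diagonal is junk.
  punchOutᵗ : ∀ {n} → Fin (suc (suc n)) → Fin (suc (suc n)) → Fin (suc n)
  punchOutᵗ a b with a ≟ b
  ... | yes _   = zero
  ... | no  a≢b = punchOut a≢b

  punchOutᵗ-punchIn : ∀ {n} (a : Fin (suc (suc n))) l → punchOutᵗ a (punchIn a l) ≡ l
  punchOutᵗ-punchIn a l with a ≟ punchIn a l
  ... | yes a≡ = ⊥-elim (Fin.punchInᵢ≢i a l (≡.sym a≡))
  ... | no  a≢ = ≡.trans (Fin.punchOut-cong a ≡.refl) (Fin.punchOut-punchIn a)

  punchIn-punchOutᵗ : ∀ {n} {a b : Fin (suc (suc n))} → a ≢ b → punchIn a (punchOutᵗ a b) ≡ b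
  punchIn-punchOutᵗ {a = a} {b} a≢b with a ≟ b
  ... | yes a≡b = ⊥-elim (a≢b a≡b)
  ... | no  a≢b = Fin.punchIn-punchOut a≢b

  -- Both sides are the sum of g over all pairs of distinct indices.
  ΣF-offDiagonal-swap : ∀ n (g : Fin (suc (suc n)) → Fin (suc (suc n)) → Carrier) →
    ΣF (suc (suc n)) (λ k → ΣF (suc n) (λ l → g k (punchIn k l))) ≈
    ΣF (suc (suc n)) (λ b → ΣF (suc n) (λ k → g (punchIn b k) b))
  ΣF-offDiagonal-swap n g = +-cancelˡ diagonal _ _ (begin
    diagonal + ΣF N (λ k → ΣF (suc n) (λ l → g k (punchIn k l)))
      ≈⟨ ΣF-distrib-+ N (λ k → g k k) (λ k → ΣF (suc n) (λ l → g k (punchIn k l))) ⟨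
    ΣF N (λ k → g k k + ΣF (suc n) (λ l → g k (punchIn k l)))
      ≈⟨ ΣF-cong N (λ k → ΣF-remove (suc n) k (g k)) ⟨
    ΣF N (λ k → ΣF N (g k))
      ≈⟨ ΣF-comm N N g ⟩
    ΣF N (λ b → ΣF N (λ k → g k b))
      ≈⟨ ΣF-cong N (λ b → ΣF-remove (suc n) b (λ k → g k b)) ⟩
    ΣF N (λ b → g b b + ΣF (suc n) (λ k → g (punchIn b k) b))
      ≈⟨ ΣF-distrib-+ N (λ b → g b b) (λ b → ΣF (suc n) (λ k → g (punchIn b k) b)) ⟩
    diagonal + ΣF N (λ b → ΣF (suc n) (λ k → g (punchIn b k) b)) ∎)
    where
      N : ℕ
      N = suc (suc n)
      diagonal : Carrier
      diagonal = ΣF N (λ k → g k k)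

  punchIn-punchIn-swap : ∀ {n} (b : Fin (suc (suc n))) (k l : Fin (suc n)) →
    punchIn (punchIn b k) l ≡ b →
    ∀ c → punchIn (punchIn b k) (punchIn l c) ≡ punchIn b (punchIn k c)
  punchIn-punchIn-swap zero    k       zero    _ c = ≡.refl
  punchIn-punchIn-swap (suc b) zero    l       e c with Fin.suc-injective e
  ... | ≡.refl = ≡.refl
  punchIn-punchIn-swap {suc n} (suc b) (suc k) (suc l) e zero    = ≡.refl
  punchIn-punchIn-swap {suc n} (suc b) (suc k) (suc l) e (suc c) =
    cong suc (punchIn-punchIn-swap b k l (Fin.suc-injective e) c)

  punchIn-punchIn-parity : ∀ {n} (b : Fin (suc (suc n))) (k l : Fin (suc n)) →
    punchIn (punchIn b k) l ≡ b →
    ∀ x → alt (toℕ (punchIn b k) +ℕ toℕ l) x ≈ alt (suc (toℕ b +ℕ toℕ k)) x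
  punchIn-punchIn-parity zero    k       zero    _ x =
    alt-≡ x (cong suc (ℕ.+-identityʳ (toℕ k)))
  punchIn-punchIn-parity (suc b) zero    l       e x with Fin.suc-injective e
  ... | ≡.refl = sym (trans (alt-suc-suc (toℕ b +ℕ 0) x) (alt-≡ x (ℕ.+-identityʳ (toℕ b))))
  punchIn-punchIn-parity {suc n} (suc b) (suc k) (suc l) e x = begin
    alt (suc K +ℕ suc L) x          ≈⟨ alt-≡ x (cong suc (ℕ.+-suc K L)) ⟩
    alt (suc (suc (K +ℕ L))) x      ≈⟨ alt-suc-suc (K +ℕ L) x ⟩
    alt (K +ℕ L) x                  ≈⟨ punchIn-punchIn-parity b k l (Fin.suc-injective e) x ⟩
    alt (suc (B +ℕ K′)) x           ≈⟨ alt-suc-suc (suc (B +ℕ K′)) x ⟨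
    alt (suc (suc (suc (B +ℕ K′)))) x ≈⟨ alt-≡ x (cong (λ z → suc (suc z)) (ℕ.+-suc B K′)) ⟨
    alt (suc (suc (B +ℕ suc K′))) x ∎
    where
      K = toℕ (punchIn b k)
      L = toℕ l
      B = toℕ b
      K′ = toℕ k

  -- The summand of det N for the entries (0, k) and (1 + j, punchIn k l), after expanding
  -- along row 0 and then along row j of the minor.
  twoRowTerm : ∀ {n} → Mat (suc (suc n)) → Fin (suc n) → Fin (suc (suc n)) → Fin (suc n) → Carrier
  twoRowTerm {n} N j k l = alt (toℕ k +ℕ (toℕ j +ℕ toℕ l))
    (N zero k * (N (suc j) (punchIn k l) * det n (minor j l (minor zero k N))))

  twoRowTerm-swap : ∀ {n} (N : Mat (suc (suc n))) j b k →
    twoRowTerm N j (punchIn b k) (punchOutᵗ (punchIn b k) b) ≈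
    alt (suc (toℕ j +ℕ toℕ b) +ℕ toℕ k)
      (N (suc j) b * (N zero (punchIn b k) * det n (minor zero k (minor (suc j) b N))))
  twoRowTerm-swap {n} N j b k = begin
    alt (K +ℕ (J +ℕ L)) x              ≈⟨ alt-≡ x (x+[y+z]≡y+[x+z] K J L) ⟩
    alt (J +ℕ (K +ℕ L)) x              ≈⟨ alt-+ J (K +ℕ L) x ⟩
    alt J (alt (K +ℕ L) x)             ≈⟨ alt-cong J (punchIn-punchIn-parity b k l l-spec x) ⟩
    alt J (alt (suc (B +ℕ toℕ k)) x)   ≈⟨ alt-+ J (suc (B +ℕ toℕ k)) x ⟨
    alt (J +ℕ suc (B +ℕ toℕ k)) x
      ≈⟨ alt-≡ x (≡.trans (ℕ.+-suc J _) (cong suc (≡.sym (ℕ.+-assoc J B (toℕ k))))) ⟩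
    alt (suc (J +ℕ B) +ℕ toℕ k) x
      ≈⟨ alt-cong (suc (J +ℕ B) +ℕ toℕ k) (trans (*-congˡ x≈) (x*[y*z]≈y*[x*z] _ _ _)) ⟩
    _ ∎
    where
      l = punchOutᵗ (punchIn b k) b
      l-spec : punchIn (punchIn b k) l ≡ b
      l-spec = punchIn-punchOutᵗ (Fin.punchInᵢ≢i b k)
      K = toℕ (punchIn b k)
      J = toℕ j
      L = toℕ l
      B = toℕ b
      x = N zero (punchIn b k) * (N (suc j) (punchIn (punchIn b k) l)
            * det n (minor j l (minor zero (punchIn b k) N)))
      x≈ : N (suc j) (punchIn (punchIn b k) l) * det n (minor j l (minor zero (punchIn b k) N))
           ≈ N (suc j) b * det n (minor zero k (minor (suc j) b N))
      x≈ = *-cong (reflexive (cong (N (suc j)) l-spec)) (det-cong n (λ r c →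
        reflexive (cong (N (suc (punchIn j r))) (punchIn-punchIn-swap b k l l-spec c))))

  -- Expand along row 0 and then along row j of the minors; summing the same terms in the
  -- other order gives the expansion along row 1 + j.
  det-expandRow : ∀ n (N : Mat (suc n)) (j : Fin (suc n)) →
    det (suc n) N ≈ ΣF (suc n) (λ b → alt (toℕ j +ℕ toℕ b) (N j b * det n (minor j b N)))
  det-expandRow n       N zero    = refl
  det-expandRow (suc n) N (suc j) = begin
    ΣF M (λ k → alt (toℕ k) (N zero k * det (suc n) (minor zero k N)))
      ≈⟨ ΣF-cong M (λ k → alt-cong (toℕ k) (*-congˡ {N zero k} (det-expandRow n (minor zero k N) j))) ⟩
    ΣF M (λ k → alt (toℕ k) (N zero k * ΣF (suc n) (λ l →
      alt (toℕ j +ℕ toℕ l) (N (suc j) (punchIn k l) * det n (minor j l (minor zero k N))))))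
      ≈⟨ ΣF-cong M (λ k → alt-*-ΣF (toℕ k) (N zero k) (suc n) (λ l → toℕ j +ℕ toℕ l)
           (λ l → N (suc j) (punchIn k l) * det n (minor j l (minor zero k N)))) ⟩
    ΣF M (λ k → ΣF (suc n) (twoRowTerm N j k))
      ≈⟨ ΣF-cong M (λ k → ΣF-cong (suc n) (λ l →
           reflexive (cong (twoRowTerm N j k) (≡.sym (punchOutᵗ-punchIn k l))))) ⟩
    ΣF M (λ k → ΣF (suc n) (λ l → g k (punchIn k l)))
      ≈⟨ ΣF-offDiagonal-swap n g ⟩
    ΣF M (λ b → ΣF (suc n) (λ k → g (punchIn b k) b))
      ≈⟨ ΣF-cong M (λ b → ΣF-cong (suc n) (twoRowTerm-swap N j b)) ⟩
    ΣF M (λ b → ΣF (suc n) (λ k → alt (suc (toℕ j +ℕ toℕ b) +ℕ toℕ k)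
      (N (suc j) b * (N zero (punchIn b k) * det n (minor zero k (minor (suc j) b N))))))
      ≈⟨ ΣF-cong M (λ b → alt-*-ΣF (suc (toℕ j +ℕ toℕ b)) (N (suc j) b) (suc n) toℕ
           (λ k → N zero (punchIn b k) * det n (minor zero k (minor (suc j) b N)))) ⟨
    ΣF M (λ b → alt (suc (toℕ j +ℕ toℕ b)) (N (suc j) b * det (suc n) (minor (suc j) b N))) ∎
    where
      M : ℕ
      M = suc (suc n)
      g : Fin M → Fin M → Carrier
      g k b = twoRowTerm N j k (punchOutᵗ k b)

  det₂ : (N : Mat 2) →
         det 2 N ≈ N zero zero * N (suc zero) (suc zero) - N zero (suc zero) * N (suc zero) zero
  det₂ N = +-cong (*-congˡ (unit _)) (trans (+-identityʳ _) (-‿cong (*-congˡ (unit _))))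
    where
      unit : ∀ x → x * 1# + 0# ≈ x
      unit x = trans (+-identityʳ _) (*-identityʳ x)

  det₂-equalRows : (N : Mat 2) → (∀ c → N zero c ≈ N (suc zero) c) → det 2 N ≈ 0#
  det₂-equalRows N row≈ = trans (det₂ N) (x≈y⇒x∙y⁻¹≈ε (begin
    N zero zero * N (suc zero) (suc zero)  ≈⟨ *-congˡ (sym (row≈ (suc zero))) ⟩
    N zero zero * N zero (suc zero)        ≈⟨ *-comm _ _ ⟩
    N zero (suc zero) * N zero zero        ≈⟨ *-congˡ (row≈ zero) ⟩
    N zero (suc zero) * N (suc zero) zero  ∎))

  anotherIndex : ∀ {n} (i j : Fin (suc (suc (suc n)))) → ∃ λ r → r ≢ i × r ≢ j
  anotherIndex zero          zero          = suc zero , (λ ()) , (λ ())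
  anotherIndex zero          (suc zero)    = suc (suc zero) , (λ ()) , (λ ())
  anotherIndex zero          (suc (suc j)) = suc zero , (λ ()) , (λ ())
  anotherIndex (suc zero)    zero          = suc (suc zero) , (λ ()) , (λ ())
  anotherIndex (suc (suc i)) zero          = suc zero , (λ ()) , (λ ())
  anotherIndex (suc i)       (suc j)       = zero , (λ ()) , (λ ())

  det-equalRows : ∀ n (N : Mat (suc n)) (i j : Fin (suc n)) → i ≢ j → (∀ c → N i c ≈ N j c) →
                  det (suc n) N ≈ 0#
  det-equalRows zero N zero zero i≢j _ = ⊥-elim (i≢j ≡.refl)
  det-equalRows (suc zero) N zero       zero       i≢j _     = ⊥-elim (i≢j ≡.refl)
  det-equalRows (suc zero) N zero       (suc zero) _   row≈ = det₂-equalRows N row≈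
  det-equalRows (suc zero) N (suc zero) zero       _   row≈ = det₂-equalRows N (λ c → sym (row≈ c))
  det-equalRows (suc zero) N (suc zero) (suc zero) i≢j _     = ⊥-elim (i≢j ≡.refl)
  det-equalRows (suc (suc n)) N i j i≢j rowᵢ≈rowⱼ = begin
    det (suc (suc (suc n))) N
      ≈⟨ det-expandRow (suc (suc n)) N r ⟩
    ΣF (suc (suc (suc n))) (λ k → alt (toℕ r +ℕ toℕ k) (N r k * det (suc (suc n)) (minor r k N)))
      ≈⟨ ΣF-zero _ (λ k → alt-zero (toℕ r +ℕ toℕ k) (trans (*-congˡ {N r k}
           (det-equalRows (suc n) (minor r k N) (punchOut r≢i) (punchOut r≢j)
             (λ e → i≢j (Fin.punchOut-injective r≢i r≢j e)) (minorRows≈ k))) (zeroʳ _))) ⟩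
    0# ∎
    where
      r = proj₁ (anotherIndex i j)
      r≢i = proj₁ (proj₂ (anotherIndex i j))
      r≢j = proj₂ (proj₂ (anotherIndex i j))
      minorRows≈ : ∀ k c → minor r k N (punchOut r≢i) c ≈ minor r k N (punchOut r≢j) c
      minorRows≈ k c = trans (reflexive (cong (λ z → N z (punchIn k c)) (Fin.punchIn-punchOut r≢i)))
        (trans (rowᵢ≈rowⱼ (punchIn k c))
               (reflexive (cong (λ z → N z (punchIn k c)) (≡.sym (Fin.punchIn-punchOut r≢j)))))

  setRow : ∀ {n} → Fin n → (Fin n → Carrier) → Mat n → Mat n
  setRow j v M r c = if does (r ≟ j) then v c else M r c

  setRow-≡ : ∀ {n} (j : Fin n) v (M : Mat n) c → setRow j v M j c ≈ v c
  setRow-≡ j v M c with j ≟ j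
  ... | yes _   = refl
  ... | no  j≢j = ⊥-elim (j≢j ≡.refl)

  setRow-≢ : ∀ {n} (j : Fin n) v (M : Mat n) {r} c → r ≢ j → setRow j v M r c ≈ M r c
  setRow-≢ j v M {r} c r≢j with r ≟ j
  ... | yes r≡j = ⊥-elim (r≢j r≡j)
  ... | no  _   = refl

  -- Entry (i, j) of M · adj M is the expansion along row j of M with row j replaced by row i.
  ·-adj : ∀ n (M : Mat n) → (M ·M adj n M) ≋ (det n M ∙M idM)
  ·-adj (suc n) M i j = begin
    ΣF (suc n) (λ k → M i k * alt (toℕ k +ℕ toℕ j) (det n (minor j k M)))
      ≈⟨ ΣF-cong (suc n) (λ k → trans (*-alt (toℕ k +ℕ toℕ j) (M i k) (det n (minor j k M)))
                                      (alt-≡ _ (ℕ.+-comm (toℕ k) (toℕ j)))) ⟩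
    ΣF (suc n) (λ k → alt (toℕ j +ℕ toℕ k) (M i k * det n (minor j k M)))
      ≈⟨ ΣF-cong (suc n) (λ k → alt-cong (toℕ j +ℕ toℕ k) (*-cong (sym (setRow-≡ j (M i) M k))
           (det-cong n (λ r c → sym (setRow-≢ j (M i) M (punchIn k c) (Fin.punchInᵢ≢i j r)))))) ⟩
    ΣF (suc n) (λ k → alt (toℕ j +ℕ toℕ k) (N j k * det n (minor j k N)))
      ≈⟨ det-expandRow n N j ⟨
    det (suc n) N
      ≈⟨ det-setRow ⟩
    det (suc n) M * idM i j ∎
    where
      N = setRow j (M i) M
      det-setRow : det (suc n) N ≈ det (suc n) M * idM i j
      det-setRow with i ≟ j
      ... | yes ≡.refl = trans (det-cong (suc n) unchanged) (sym (*-identityʳ _))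
        where
          unchanged : N ≋ M
          unchanged r c with r ≟ i
          ... | yes ≡.refl = refl
          ... | no  _      = refl
      ... | no i≢j = trans (det-equalRows n N i j i≢j
                             (λ c → trans (setRow-≢ j (M i) M c i≢j) (sym (setRow-≡ j (M i) M c))))
                           (sym (zeroʳ _))

module PowerSeries {c ℓ} (F : CommutativeRing c ℓ) where
  open CommutativeRing F hiding (zero; ring)
  open Over F using (PS; _≈ₚ_; 0ₚ; 1ₚ; X; const; _+ₚ_; -ₚ_; _*ₚ_; sumTo)
  open import Relation.Binary.Reasoning.Setoid setoid
  open CommSemigroupProperties +-commutativeSemigroup using ()
    renaming (interchange to +-interchange)

  sumTo-cong : ∀ n {f g : ℕ → Carrier} → (∀ i → i < n → f i ≈ g i) → sumTo f n ≈ sumTo g n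
  sumTo-cong zero    f≈g = refl
  sumTo-cong (suc n) f≈g = +-cong (sumTo-cong n (λ i i<n → f≈g i (ℕ.m<n⇒m<1+n i<n))) (f≈g n ℕ.≤-refl)

  sumTo-zero : ∀ n {f : ℕ → Carrier} → (∀ i → f i ≈ 0#) → sumTo f n ≈ 0#
  sumTo-zero zero    f≈0 = refl
  sumTo-zero (suc n) f≈0 = trans (+-cong (sumTo-zero n f≈0) (f≈0 n)) (+-identityˡ _)

  sumTo-suc : ∀ n (f : ℕ → Carrier) → sumTo f (suc n) ≈ f 0 + sumTo (λ i → f (suc i)) n
  sumTo-suc zero    f = +-comm _ _
  sumTo-suc (suc n) f = trans (+-congʳ (sumTo-suc n f)) (+-assoc _ _ _)

  sumTo-distrib-+ : ∀ n (f g : ℕ → Carrier) → sumTo (λ i → f i + g i) n ≈ sumTo f n + sumTo g n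
  sumTo-distrib-+ zero    f g = sym (+-identityˡ _)
  sumTo-distrib-+ (suc n) f g = trans (+-congʳ (sumTo-distrib-+ n f g)) (+-interchange _ _ _ _)

  *-distribˡ-sumTo : ∀ n x (f : ℕ → Carrier) → x * sumTo f n ≈ sumTo (λ i → x * f i) n
  *-distribˡ-sumTo zero    x f = zeroʳ x
  *-distribˡ-sumTo (suc n) x f = trans (distribˡ _ _ _) (+-congʳ (*-distribˡ-sumTo n x f))

  tail : PS → PS
  tail f i = f (suc i)

  _∙ₚ_ : Carrier → PS → PS
  (x ∙ₚ f) i = x * f i

  *ₚ-zeroth : ∀ f g → (f *ₚ g) 0 ≈ f 0 * g 0
  *ₚ-zeroth f g = +-identityˡ _

  *ₚ-suc-tailˡ : ∀ f g k → (f *ₚ g) (suc k) ≈ f 0 * g (suc k) + (tail f *ₚ g) k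
  *ₚ-suc-tailˡ f g k = sumTo-suc (suc k) (λ i → f i * g (suc k ∸ i))

  *ₚ-suc-tailʳ : ∀ f g k → (f *ₚ g) (suc k) ≈ (f *ₚ tail g) k + f (suc k) * g 0
  *ₚ-suc-tailʳ f g k = +-cong
    (sumTo-cong (suc k) (λ i i≤k → *-congˡ (reflexive (cong g (ℕ.+-∸-assoc 1 (s≤s⁻¹ i≤k))))))
    (*-congˡ (reflexive (cong g (ℕ.n∸n≡0 k))))

  *ₚ-congˡ : ∀ {f f′} g → f ≈ₚ f′ → (f *ₚ g) ≈ₚ (f′ *ₚ g)
  *ₚ-congˡ g f≈f′ k = sumTo-cong (suc k) (λ i _ → *-congʳ (f≈f′ i))

  *ₚ-congʳ : ∀ f {g g′} → g ≈ₚ g′ → (f *ₚ g) ≈ₚ (f *ₚ g′)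
  *ₚ-congʳ f g≈g′ k = sumTo-cong (suc k) (λ i _ → *-congˡ (g≈g′ (k ∸ i)))

  *ₚ-comm : ∀ f g → (f *ₚ g) ≈ₚ (g *ₚ f)
  *ₚ-comm f g zero    = +-congˡ (*-comm _ _)
  *ₚ-comm f g (suc k) = begin
    (f *ₚ g) (suc k)                 ≈⟨ *ₚ-suc-tailˡ f g k ⟩
    f 0 * g (suc k) + (tail f *ₚ g) k ≈⟨ +-cong (*-comm _ _) (*ₚ-comm (tail f) g k) ⟩
    g (suc k) * f 0 + (g *ₚ tail f) k ≈⟨ +-comm _ _ ⟩
    (g *ₚ tail f) k + g (suc k) * f 0 ≈⟨ *ₚ-suc-tailʳ g f k ⟨
    (g *ₚ f) (suc k)                 ∎

  *ₚ-distribʳ : ∀ h f g → ((f +ₚ g) *ₚ h) ≈ₚ ((f *ₚ h) +ₚ (g *ₚ h))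
  *ₚ-distribʳ h f g k = trans (sumTo-cong (suc k) (λ i _ → distribʳ _ _ _)) (sumTo-distrib-+ (suc k) _ _)

  *ₚ-distribˡ : ∀ h f g → (h *ₚ (f +ₚ g)) ≈ₚ ((h *ₚ f) +ₚ (h *ₚ g))
  *ₚ-distribˡ h f g k = trans (sumTo-cong (suc k) (λ i _ → distribˡ _ _ _)) (sumTo-distrib-+ (suc k) _ _)

  ∙ₚ-*ₚ : ∀ x f g → ((x ∙ₚ f) *ₚ g) ≈ₚ (x ∙ₚ (f *ₚ g))
  ∙ₚ-*ₚ x f g k = trans (sumTo-cong (suc k) (λ i _ → *-assoc _ _ _)) (sym (*-distribˡ-sumTo (suc k) x _))

  *ₚ-assoc : ∀ f g h → ((f *ₚ g) *ₚ h) ≈ₚ (f *ₚ (g *ₚ h))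
  *ₚ-assoc f g h zero = begin
    ((f *ₚ g) *ₚ h) 0    ≈⟨ trans (*ₚ-zeroth (f *ₚ g) h) (*-congʳ (*ₚ-zeroth f g)) ⟩
    f 0 * g 0 * h 0      ≈⟨ *-assoc _ _ _ ⟩
    f 0 * (g 0 * h 0)    ≈⟨ trans (*ₚ-zeroth f (g *ₚ h)) (*-congˡ (*ₚ-zeroth g h)) ⟨
    (f *ₚ (g *ₚ h)) 0    ∎
  *ₚ-assoc f g h (suc k) = begin
    ((f *ₚ g) *ₚ h) (suc k)
      ≈⟨ *ₚ-suc-tailˡ (f *ₚ g) h k ⟩
    (f *ₚ g) 0 * h (suc k) + (tail (f *ₚ g) *ₚ h) k
      ≈⟨ +-cong (*-congʳ (*ₚ-zeroth f g)) (*ₚ-congˡ h (*ₚ-suc-tailˡ f g) k) ⟩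
    f 0 * g 0 * h (suc k) + (((f 0 ∙ₚ tail g) +ₚ (tail f *ₚ g)) *ₚ h) k
      ≈⟨ +-congˡ (*ₚ-distribʳ h (f 0 ∙ₚ tail g) (tail f *ₚ g) k) ⟩
    f 0 * g 0 * h (suc k) + (((f 0 ∙ₚ tail g) *ₚ h) k + ((tail f *ₚ g) *ₚ h) k)
      ≈⟨ +-congˡ (+-cong (∙ₚ-*ₚ (f 0) (tail g) h k) (*ₚ-assoc (tail f) g h k)) ⟩
    f 0 * g 0 * h (suc k) + (f 0 * (tail g *ₚ h) k + (tail f *ₚ (g *ₚ h)) k)
      ≈⟨ +-assoc _ _ _ ⟨
    (f 0 * g 0 * h (suc k) + f 0 * (tail g *ₚ h) k) + (tail f *ₚ (g *ₚ h)) k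
      ≈⟨ +-congʳ (trans (+-congʳ (*-assoc _ _ _)) (sym (distribˡ _ _ _))) ⟩
    f 0 * (g 0 * h (suc k) + (tail g *ₚ h) k) + (tail f *ₚ (g *ₚ h)) k
      ≈⟨ +-congʳ (*-congˡ (*ₚ-suc-tailˡ g h k)) ⟨
    f 0 * (g *ₚ h) (suc k) + (tail f *ₚ (g *ₚ h)) k
      ≈⟨ *ₚ-suc-tailˡ f (g *ₚ h) k ⟨
    (f *ₚ (g *ₚ h)) (suc k) ∎

  *ₚ-identityˡ : ∀ f → (1ₚ *ₚ f) ≈ₚ f
  *ₚ-identityˡ f zero    = trans (*ₚ-zeroth 1ₚ f) (*-identityˡ _)
  *ₚ-identityˡ f (suc k) = begin
    (1ₚ *ₚ f) (suc k)                    ≈⟨ *ₚ-suc-tailˡ 1ₚ f k ⟩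
    1# * f (suc k) + (tail 1ₚ *ₚ f) k    ≈⟨ +-cong (*-identityˡ _) (sumTo-zero (suc k) (λ i → zeroˡ _)) ⟩
    f (suc k) + 0#                       ≈⟨ +-identityʳ _ ⟩
    f (suc k)                            ∎

  const-*ₚ : ∀ b f t → (const b *ₚ f) t ≈ b * f t
  const-*ₚ b f zero    = *ₚ-zeroth (const b) f
  const-*ₚ b f (suc t) = begin
    (const b *ₚ f) (suc t)                        ≈⟨ *ₚ-suc-tailˡ (const b) f t ⟩
    b * f (suc t) + (tail (const b) *ₚ f) t       ≈⟨ +-congˡ (sumTo-zero (suc t) (λ i → zeroˡ _)) ⟩
    b * f (suc t) + 0#                            ≈⟨ +-identityʳ _ ⟩
    b * f (suc t)                                 ∎

  X-*ₚ-zero : ∀ f → (X *ₚ f) 0 ≈ 0#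
  X-*ₚ-zero f = trans (*ₚ-zeroth X f) (zeroˡ _)

  X-*ₚ-suc : ∀ f t → (X *ₚ f) (suc t) ≈ f t
  X-*ₚ-suc f t = begin
    (X *ₚ f) (suc t)               ≈⟨ *ₚ-suc-tailˡ X f t ⟩
    0# * f (suc t) + (tail X *ₚ f) t ≈⟨ +-cong (zeroˡ _) (*ₚ-congˡ f tail-X t) ⟩
    0# + (1ₚ *ₚ f) t               ≈⟨ +-identityˡ _ ⟩
    (1ₚ *ₚ f) t                    ≈⟨ *ₚ-identityˡ f t ⟩
    f t                            ∎
    where
      tail-X : tail X ≈ₚ 1ₚ
      tail-X zero    = refl
      tail-X (suc k) = refl

  ring : CommutativeRing c ℓ
  ring = record
    { Carrier = PS ; _≈_ = _≈ₚ_ ; _+_ = _+ₚ_ ; _*_ = _*ₚ_ ; -_ = -ₚ_ ; 0# = 0ₚ ; 1# = 1ₚ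
    ; isCommutativeRing = record
      { isRing = record
        { +-isAbelianGroup = Pointwise.isAbelianGroup ℕ +-isAbelianGroup
        ; *-cong     = λ {f} {f′} {g} {g′} f≈f′ g≈g′ k →
                         trans (*ₚ-congˡ g f≈f′ k) (*ₚ-congʳ f′ g≈g′ k)
        ; *-assoc    = *ₚ-assoc
        ; *-identity = *ₚ-identityˡ , λ f k → trans (*ₚ-comm f 1ₚ k) (*ₚ-identityˡ f k)
        ; distrib    = *ₚ-distribˡ , *ₚ-distribʳ
        }
      ; *-comm = *ₚ-comm
      }
    }

module Evaluation {c ℓ} (F : CommutativeRing c ℓ) {n : ℕ} (A : Over.Mat F n) where
  open CommutativeRing F hiding (zero)
  open Over F using (PS; evalM)
  open Matrices F

  evalM-cong : ∀ e {p q : PS} → (∀ s → s ≤ e → p s ≈ q s) → evalM e p A ≋ evalM e q A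
  evalM-cong zero    p≈q = ∙-cong (p≈q 0 z≤n) ≋-refl
  evalM-cong (suc e) p≈q = +M-cong (evalM-cong e (λ s s≤e → p≈q s (ℕ.m≤n⇒m≤1+n s≤e)))
                                   (∙-cong (p≈q (suc e) ℕ.≤-refl) ≋-refl)

  evalM-zero : ∀ e {p : PS} → (∀ s → s ≤ e → p s ≈ 0#) → evalM e p A ≋ zeroM
  evalM-zero zero    p≈0 = ∙-zeroˡ idM (p≈0 0 z≤n)
  evalM-zero (suc e) p≈0 = ≋-trans
    (+M-cong (evalM-zero e (λ s s≤e → p≈0 s (ℕ.m≤n⇒m≤1+n s≤e))) (∙-zeroˡ _ (p≈0 (suc e) ℕ.≤-refl)))
    (+M-identityʳ zeroM)

  evalM-horner : ∀ e (p : PS) →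
    evalM (suc e) p A ≋ ((p 0 ∙M idM) +M (A ·M evalM e (λ s → p (suc s)) A))
  evalM-horner zero    p = +M-cong ≋-refl (≋-sym (·-∙ʳ (p 1) A idM))
  evalM-horner (suc e) p = begin
    (evalM (suc e) p A +M (p (suc (suc e)) ∙M (A ^M suc (suc e))))
      ≈⟨ +M-cong (evalM-horner e p) ≋-refl ⟩
    (((p 0 ∙M idM) +M (A ·M evalM e p′ A)) +M (p (suc (suc e)) ∙M (A ·M (A ^M suc e))))
      ≈⟨ +M-assoc _ _ _ ⟩
    ((p 0 ∙M idM) +M ((A ·M evalM e p′ A) +M (p (suc (suc e)) ∙M (A ·M (A ^M suc e)))))
      ≈⟨ +M-cong ≋-refl (+M-cong ≋-refl (·-∙ʳ _ A _)) ⟨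
    ((p 0 ∙M idM) +M ((A ·M evalM e p′ A) +M (A ·M (p (suc (suc e)) ∙M (A ^M suc e)))))
      ≈⟨ +M-cong ≋-refl (·-distribˡ A _ _) ⟨
    ((p 0 ∙M idM) +M (A ·M evalM (suc e) p′ A)) ∎
    where
      open ≋-Reasoning
      p′ : PS
      p′ s = p (suc s)

  evalM-extend : ∀ e k (p : PS) → (∀ s → e < s → p s ≈ 0#) → evalM (k +ℕ e) p A ≋ evalM e p A
  evalM-extend e zero    p p≈0 = ≋-refl
  evalM-extend e (suc k) p p≈0 = ≋-trans
    (+M-cong (evalM-extend e k p p≈0) (∙-zeroˡ _ (p≈0 (suc (k +ℕ e)) (s≤s (ℕ.m≤n+m e k)))))
    (+M-identityʳ _)

  evalM-∙ : ∀ e x (p : PS) → evalM e (λ s → x * p s) A ≋ (x ∙M evalM e p A)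
  evalM-∙ zero    x p i j = *-assoc _ _ _
  evalM-∙ (suc e) x p i j = trans (+-cong (evalM-∙ e x p i j) (*-assoc _ _ _)) (sym (distribˡ _ _ _))

  evalM-lincomb : ∀ e {k} (cs : Fin k → Carrier) (p : Fin k → PS) →
    evalM e (λ s → ΣF k (λ t → cs t * p t s)) A ≋ lincomb cs (λ t → evalM e (p t) A)
  evalM-lincomb zero    {k} cs p i j = trans (*-distribʳ-ΣF k _ _) (ΣF-cong k (λ t → *-assoc _ _ _))
  evalM-lincomb (suc e) {k} cs p i j = trans
    (+-cong (evalM-lincomb e cs p i j) (trans (*-distribʳ-ΣF k _ _) (ΣF-cong k (λ t → *-assoc _ _ _))))
    (trans (sym (ΣF-distrib-+ k _ _)) (ΣF-cong k (λ t → sym (distribˡ _ _ _))))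

module CharacteristicMatrix {c ℓ} (F : CommutativeRing c ℓ) {n : ℕ} (A : Over.Mat F n) where
  open CommutativeRing F hiding (zero; ring)
  open Over F using (PS; X; const; 0ₚ; 1ₚ; _*ₚ_; liftM; xI-A)
  open Matrices F
  open PowerSeries F
  module P = Matrices (PowerSeries.ring F)
  open import Algebra.Properties.Ring (CommutativeRing.ring F) using (-‿injective)

  coeff : ℕ → P.Mat n → Mat n
  coeff t Y i j = Y i j t

  coeff-ΣF : ∀ k (f : Fin k → PS) t → P.ΣF k f t ≡ ΣF k (λ i → f i t)
  coeff-ΣF zero    f t = ≡.refl
  coeff-ΣF (suc k) f t = cong (f zero t +_) (coeff-ΣF k (λ i → f (suc i)) t)

  coeff-·liftM : ∀ (Y : P.Mat n) C t → coeff t (Y P.·M liftM C) ≋ (coeff t Y ·M C)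
  coeff-·liftM Y C t i j = trans (reflexive (coeff-ΣF n (λ k → Y i k *ₚ const (C k j)) t))
    (ΣF-cong n (λ k → trans (*ₚ-comm (Y i k) (const (C k j)) t)
                            (trans (const-*ₚ (C k j) (Y i k) t) (*-comm _ _))))

  coeff-liftM· : ∀ (Y : P.Mat n) C t → coeff t (liftM C P.·M Y) ≋ (C ·M coeff t Y)
  coeff-liftM· Y C t i j = trans (reflexive (coeff-ΣF n (λ k → const (C i k) *ₚ Y k j) t))
    (ΣF-cong n (λ k → const-*ₚ (C i k) (Y k j) t))

  coeff-∙idM : ∀ f t → coeff t (f P.∙M P.idM) ≋ (f t ∙M idM)
  coeff-∙idM f t i j with does (i ≟ j)
  ... | true  = trans (*ₚ-comm f 1ₚ t) (trans (*ₚ-identityˡ f t) (sym (*-identityʳ _)))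
  ... | false = trans (*ₚ-comm f 0ₚ t) (trans (sumTo-zero (suc t) (λ i → zeroˡ _)) (sym (zeroʳ _)))

  previous : ℕ → P.Mat n → Mat n
  previous zero    Y = zeroM
  previous (suc t) Y = coeff t Y

  coeff-xI-A· : ∀ Y t → coeff t (xI-A A P.·M Y) ≋ (previous t Y +M (-M (A ·M coeff t Y)))
  coeff-xI-A· Y t i j = trans (expand i j t) (+-cong (X-shift t) (-‿cong (coeff-liftM· Y A t i j)))
    where
      expand : (xI-A A P.·M Y) P.≋ ((X P.∙M Y) P.+M (P.-M (liftM A P.·M Y)))
      expand = P.≋-trans (P.·-distribʳ Y _ _)
        (P.+M-cong (P.≋-trans (P.·-∙ˡ X P.idM Y) (P.∙-cong {x = X} (λ _ → refl) (P.·-identityˡ Y)))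
                   (P.·-negˡ _ Y))
      X-shift : ∀ t → (X *ₚ Y i j) t ≈ previous t Y i j
      X-shift zero    = X-*ₚ-zero (Y i j)
      X-shift (suc t) = X-*ₚ-suc (Y i j) t

  -- Coefficientwise, (xI - A) Y = (xI - A) Z reads Y₍ₜ₋₁₎ - A Yₜ = Z₍ₜ₋₁₎ - A Zₜ,
  -- so a left inverse of A recovers Yₜ = Zₜ by induction on t.
  xI-A-cancelˡ : ∀ {B} → (B ·M A) ≋ idM →
                 ∀ {Y Z} → (xI-A A P.·M Y) P.≋ (xI-A A P.·M Z) → Y P.≋ Z
  xI-A-cancelˡ {B} BA≋I {Y} {Z} MY≋MZ i j t = coeff≋ t i j
    where
      previous≋ : ∀ t → previous t Y ≋ previous t Z → coeff t Y ≋ coeff t Z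
      previous≋ t prev≋ = ·-cancelˡ BA≋I λ i j →
        -‿injective (+-cancelˡ (previous t Y i j) _ _ (trans (sym (coeff-xI-A· Y t i j))
          (trans (MY≋MZ i j t) (trans (coeff-xI-A· Z t i j) (+-congʳ (sym (prev≋ i j)))))))
      coeff≋ : ∀ t → coeff t Y ≋ coeff t Z
      coeff≋ zero    = previous≋ zero ≋-refl
      coeff≋ (suc t) = previous≋ (suc t) (coeff≋ t)

module Quotient {c ℓ} (F : CommutativeRing c ℓ) {n : ℕ} (A : Over.Mat F n)
  (d : ℕ) (m : Over.PS F) (m-degree : Over.DegLt F (suc d) m)
  (m[A]≋0 : Matrices._≋_ F (Over.evalM F d m A) (Matrices.zeroM F)) where
  open CommutativeRing F hiding (zero; ring)
  open Over F using (PS; _≈ₚ_; _*ₚ_; evalM; xI-A)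
  open Matrices F
  open Evaluation F A
  open CharacteristicMatrix F A

  -- Horner's scheme for m(A): horner 0 = m(A), and the horner (t + 1) are the
  -- coefficients of the matrix polynomial (m(x) I - m(A)) / (x I - A).
  horner : ℕ → Mat n
  horner t = evalM d (λ s → m (t +ℕ s)) A

  horner-step : ∀ t → horner t ≋ ((m t ∙M idM) +M (A ·M horner (suc t)))
  horner-step t = begin
    evalM d m[t+_] A
      ≈⟨ evalM-extend d 1 m[t+_] (λ s d<s → m-degree (t +ℕ s) (ℕ.≤-trans d<s (ℕ.m≤n+m s t))) ⟨
    evalM (suc d) m[t+_] A
      ≈⟨ evalM-horner d m[t+_] ⟩
    (m (t +ℕ 0) ∙M idM) +M (A ·M evalM d (λ s → m (t +ℕ suc s)) A)
      ≈⟨ +M-cong (∙-cong (reflexive (cong m (ℕ.+-identityʳ t))) ≋-refl)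
                 (·-cong ≋-refl (evalM-cong d (λ s _ → reflexive (cong m (ℕ.+-suc t s))))) ⟩
    (m t ∙M idM) +M (A ·M horner (suc t)) ∎
    where
      open ≋-Reasoning
      m[t+_] : PS
      m[t+ s ] = m (t +ℕ s)

  horner-vanishes : ∀ t → d < t → horner t ≋ zeroM
  horner-vanishes t d<t = evalM-zero d (λ s _ → m-degree (t +ℕ s) (ℕ.≤-trans d<t (ℕ.m≤m+n t s)))

  quotient : P.Mat n
  quotient i j t = horner (suc t) i j

  xI-A·quotient : (xI-A A P.·M quotient) P.≋ (m P.∙M P.idM)
  xI-A·quotient i j t = begin
    coeff t (xI-A A P.·M quotient) i j                    ≈⟨ coeff-xI-A· quotient t i j ⟩
    previous t quotient i j - (A ·M horner (suc t)) i j  ≈⟨ +-congʳ (previous-quotient t i j) ⟩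
    horner t i j - (A ·M horner (suc t)) i j             ≈⟨ x≈z//y _ _ _ (sym (horner-step t i j)) ⟨
    m t * idM i j                                        ≈⟨ coeff-∙idM m t i j ⟨
    coeff t (m P.∙M P.idM) i j                           ∎
    where
      open import Relation.Binary.Reasoning.Setoid setoid
      previous-quotient : ∀ t → previous t quotient ≋ horner t
      previous-quotient zero    = ≋-sym m[A]≋0
      previous-quotient (suc t) = ≋-refl

  quotientTrace : Mat n → PS
  quotientTrace A₁ t = trace ((horner (suc t) ·M A) ·M A₁)

  quotientTrace-degree : ∀ A₁ → Over.DegLt F d (quotientTrace A₁)
  quotientTrace-degree A₁ t d≤t = trace-zero (≋-trans (·-cong Qₜ·A≋0 ≋-refl) (·-zeroˡ A₁))
    where
      Qₜ·A≋0 : (horner (suc t) ·M A) ≋ zeroM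
      Qₜ·A≋0 = ≋-trans (·-cong (horner-vanishes (suc t) (s≤s d≤t)) ≋-refl) (·-zeroˡ A)

  module _ {B : Mat n} (BA≋I : (B ·M A) ≋ idM)
           (h : PS) (h*m≈char : (h *ₚ m) ≈ₚ Over.char F A) where

    adj-xI-A : P.adj n (xI-A A) P.≋ (h P.∙M quotient)
    adj-xI-A = xI-A-cancelˡ BA≋I (begin
      xI-A A P.·M P.adj n (xI-A A)    ≈⟨ Determinants.·-adj (PowerSeries.ring F) n (xI-A A) ⟩
      Over.char F A P.∙M P.idM        ≈⟨ P.∙-cong {M = P.idM} (λ t → sym (h*m≈char t)) P.≋-refl ⟩
      (h *ₚ m) P.∙M P.idM             ≈⟨ P.∙-assoc h m P.idM ⟩
      h P.∙M (m P.∙M P.idM)           ≈⟨ P.∙-cong {x = h} (λ _ → refl) xI-A·quotient ⟨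
      h P.∙M (xI-A A P.·M quotient)   ≈⟨ P.·-∙ʳ h (xI-A A) quotient ⟨
      xI-A A P.·M (h P.∙M quotient)   ∎)
      where open P.≋-Reasoning

    ∂char≈h*quotientTrace : ∀ A₁ → Over.∂char F A A₁ ≈ₚ (h *ₚ quotientTrace A₁)
    ∂char≈h*quotientTrace A₁ t = begin
      Over.∂char F A A₁ t
        ≈⟨ P.trace-cong (P.·-cong (P.·-cong adj-xI-A (P.≋-refl {M = liftA})) (P.≋-refl {M = liftA₁})) t ⟩
      P.trace (((h P.∙M quotient) P.·M liftA) P.·M liftA₁) t
        ≈⟨ P.trace-cong (P.≋-trans (P.·-cong (P.·-∙ˡ h quotient liftA) (P.≋-refl {M = liftA₁}))
                                   (P.·-∙ˡ h (quotient P.·M liftA) liftA₁)) t ⟩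
      P.trace (h P.∙M ((quotient P.·M liftA) P.·M liftA₁)) t
        ≈⟨ P.trace-∙ h ((quotient P.·M liftA) P.·M liftA₁) t ⟩
      (h *ₚ P.trace ((quotient P.·M liftA) P.·M liftA₁)) t
        ≈⟨ PowerSeries.*ₚ-congʳ F h coeff-trace t ⟩
      (h *ₚ quotientTrace A₁) t ∎
      where
        open import Relation.Binary.Reasoning.Setoid setoid
        liftA liftA₁ : P.Mat n
        liftA  = Over.liftM F A
        liftA₁ = Over.liftM F A₁
        coeff-trace : P.trace ((quotient P.·M liftA) P.·M liftA₁) ≈ₚ quotientTrace A₁
        coeff-trace t = trans (reflexive (coeff-ΣF n (λ i → ((quotient P.·M liftA) P.·M liftA₁) i i) t))
          (trace-cong (≋-trans (coeff-·liftM (quotient P.·M liftA) A₁ t)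
                               (·-cong (coeff-·liftM quotient A t) ≋-refl)))

module TraceForm {c ℓ} (R : CommutativeRing c ℓ) where
  open CommutativeRing R hiding (zero)
  open Matrices R
  open import Relation.Binary.Reasoning.Setoid setoid

  ⟨_,_⟩ : ∀ {n} → Mat n → Mat n → Carrier
  ⟨ V , W ⟩ = trace (V ·M W)

  ⟨⟩-subʳ : ∀ {n} (V W W′ : Mat n) → ⟨ V , W +M (-M W′) ⟩ ≈ ⟨ V , W ⟩ - ⟨ V , W′ ⟩
  ⟨⟩-subʳ {n} V W W′ = begin
    trace (V ·M (W +M (-M W′)))               ≈⟨ trace-cong (·-distribˡ V W (-M W′)) ⟩
    trace ((V ·M W) +M (V ·M (-M W′)))        ≈⟨ ΣF-distrib-+ n _ _ ⟩
    ⟨ V , W ⟩ + trace (V ·M (-M W′))          ≈⟨ +-congˡ (trace-cong (·-negʳ V W′)) ⟩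
    ⟨ V , W ⟩ + ΣF n (λ i → - (V ·M W′) i i) ≈⟨ +-congˡ (-‿distrib-ΣF n _) ⟨
    ⟨ V , W ⟩ - ⟨ V , W′ ⟩                    ∎

  ⟨⟩-subˡ : ∀ {n} (V V′ W : Mat n) → ⟨ V +M (-M V′) , W ⟩ ≈ ⟨ V , W ⟩ - ⟨ V′ , W ⟩
  ⟨⟩-subˡ {n} V V′ W = begin
    trace ((V +M (-M V′)) ·M W)               ≈⟨ trace-cong (·-distribʳ W V (-M V′)) ⟩
    trace ((V ·M W) +M ((-M V′) ·M W))        ≈⟨ ΣF-distrib-+ n _ _ ⟩
    ⟨ V , W ⟩ + trace ((-M V′) ·M W)          ≈⟨ +-congˡ (trace-cong (·-negˡ V′ W)) ⟩
    ⟨ V , W ⟩ + ΣF n (λ i → - (V′ ·M W) i i) ≈⟨ +-congˡ (-‿distrib-ΣF n _) ⟨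
    ⟨ V , W ⟩ - ⟨ V′ , W ⟩                    ∎

  ⟨⟩-∙ʳ : ∀ {n} x (V W : Mat n) → ⟨ V , x ∙M W ⟩ ≈ x * ⟨ V , W ⟩
  ⟨⟩-∙ʳ x V W = trans (trace-cong (·-∙ʳ x V W)) (trace-∙ x (V ·M W))

  ⟨⟩-lincombʳ : ∀ {n k} (V : Mat n) (cs : Fin k → Carrier) (W : Fin k → Mat n) →
                ⟨ V , lincomb cs W ⟩ ≈ ΣF k (λ t → cs t * ⟨ V , W t ⟩)
  ⟨⟩-lincombʳ V cs W = trans (trace-cong (·-distribˡ-lincomb V cs W)) (trace-lincomb cs (λ t → V ·M W t))

  ⟨⟩-lincombˡ : ∀ {n k} (cs : Fin k → Carrier) (V : Fin k → Mat n) (W : Mat n) →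
                ⟨ lincomb cs V , W ⟩ ≈ ΣF k (λ t → cs t * ⟨ V t , W ⟩)
  ⟨⟩-lincombˡ cs V W = trans (trace-cong (·-distribʳ-lincomb cs V W)) (trace-lincomb cs (λ t → V t ·M W))

  matrixUnit : ∀ {n} → Fin n → Fin n → Mat n
  matrixUnit a b r s = idM a r * idM b s

  ⟨⟩-matrixUnit : ∀ {n} (V : Mat n) i j → ⟨ V , matrixUnit j i ⟩ ≈ V i j
  ⟨⟩-matrixUnit {n} V i j = begin
    ΣF n (λ r → ΣF n (λ k → V r k * (idM j k * idM i r)))
      ≈⟨ ΣF-cong n (λ r → ΣF-cong n (λ k → x*[y*z]≈y*[x*z] _ _ _)) ⟩
    ΣF n (λ r → ΣF n (λ k → idM j k * (V r k * idM i r)))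
      ≈⟨ ΣF-cong n (λ r → ΣF-idMˡ n j (λ k → V r k * idM i r)) ⟩
    ΣF n (λ r → V r j * idM i r)
      ≈⟨ ΣF-cong n (λ r → *-comm _ _) ⟩
    ΣF n (λ r → idM i r * V r j)
      ≈⟨ ΣF-idMˡ n i (λ r → V r j) ⟩
    V i j ∎

record IsDiscreteField {c ℓ} (F : CommutativeRing c ℓ) : Set (c ⊔ ℓ) where
  open CommutativeRing F using (_≈_; 0#; 1#; _*_)
  field
    1≉0     : ¬ (1# ≈ 0#)
    inverse : ∀ x → ¬ (x ≈ 0#) → ∃ λ y → x * y ≈ 1#
    _≟F_    : Decidable _≈_

module DualFamilies {c ℓ} (F : CommutativeRing c ℓ) (isDiscreteField : IsDiscreteField F) where
  open CommutativeRing F hiding (zero)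
  open IsDiscreteField isDiscreteField
  open Matrices F
  open TraceForm F
  open import Relation.Binary.Reasoning.Setoid setoid

  Independent : ∀ {n k} → (Fin k → Mat n) → Set (c ⊔ ℓ)
  Independent {k = k} v = ∀ (cs : Fin k → Carrier) → lincomb cs v ≋ zeroM → ∀ t → cs t ≈ 0#

  Independent-tail : ∀ {n k} {v : Fin (suc k) → Mat n} → Independent v → Independent (λ t → v (suc t))
  Independent-tail indep cs Σ≋0 t =
    indep (0# ∷ cs) (λ i j → trans (+-cong (zeroˡ _) (Σ≋0 i j)) (+-identityˡ _)) (suc t)

  nonzeroEntry : ∀ {n} (V : Mat n) → ¬ (V ≋ zeroM) → ∃ λ i → ∃ λ j → ¬ (V i j ≈ 0#)
  nonzeroEntry {n} V V≉0
    with i , rowᵢ≉0 ← Fin.¬∀⟶∃¬ n _ (λ i → Fin.all? (λ j → V i j ≟F 0#)) V≉0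
    with j , Vᵢⱼ≉0  ← Fin.¬∀⟶∃¬ n _ (λ j → V i j ≟F 0#) rowᵢ≉0
    = i , j , Vᵢⱼ≉0

  ⟨⟩-nondegenerate : ∀ {n} (V : Mat n) → ¬ (V ≋ zeroM) → Σ (Mat n) λ W → ⟨ V , W ⟩ ≈ 1#
  ⟨⟩-nondegenerate V V≉0 with i , j , Vᵢⱼ≉0 ← nonzeroEntry V V≉0 with y , Vᵢⱼy≈1 ← inverse _ Vᵢⱼ≉0 =
    y ∙M matrixUnit j i ,
    trans (⟨⟩-∙ʳ y V _) (trans (*-congˡ (⟨⟩-matrixUnit V i j)) (trans (*-comm _ _) Vᵢⱼy≈1))

  -- Induction on the family: make v 0 orthogonal to the dual family w′ of the tail,
  -- pair the result with some e, and correct e and w′ by multiples of each other.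
  dualFamily : ∀ {n} k (v : Fin k → Mat n) → Independent v →
               Σ (Fin k → Mat n) λ w → ∀ s t → ⟨ v s , w t ⟩ ≈ idM s t
  dualFamily zero    v _     = (λ ()) , (λ ())
  dualFamily {n} (suc k) v indep = w , dual
    where
      v′ : Fin k → Mat n
      v′ t = v (suc t)
      w′ : Fin k → Mat n
      w′ = proj₁ (dualFamily k v′ (Independent-tail {v = v} indep))
      dual′ : ∀ s t → ⟨ v′ s , w′ t ⟩ ≈ idM s t
      dual′ = proj₂ (dualFamily k v′ (Independent-tail {v = v} indep))

      α : Fin k → Carrier
      α t = ⟨ v zero , w′ t ⟩
      u : Mat n
      u = v zero +M (-M lincomb α v′)
      u≉0 : ¬ (u ≋ zeroM)
      u≉0 u≋0 = 1≉0 (indep (1# ∷ λ t → - α t) (λ i j → trans (+-cong (*-identityˡ _)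
        (trans (ΣF-cong k (λ t → sym (-‿distribˡ-* _ _))) (sym (-‿distrib-ΣF k _)))) (u≋0 i j)) zero)
      e : Mat n
      e = proj₁ (⟨⟩-nondegenerate u u≉0)
      ⟨u,e⟩≈1 : ⟨ u , e ⟩ ≈ 1#
      ⟨u,e⟩≈1 = proj₂ (⟨⟩-nondegenerate u u≉0)

      β : Fin k → Carrier
      β t = ⟨ v′ t , e ⟩
      w₀ : Mat n
      w₀ = e +M (-M lincomb β w′)
      w : Fin (suc k) → Mat n
      w zero    = w₀
      w (suc t) = w′ t +M (-M (α t ∙M w₀))

      ⟨v′,w₀⟩≈0 : ∀ s → ⟨ v′ s , w₀ ⟩ ≈ 0#
      ⟨v′,w₀⟩≈0 s = begin
        ⟨ v′ s , w₀ ⟩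
          ≈⟨ ⟨⟩-subʳ (v′ s) e _ ⟩
        β s - ⟨ v′ s , lincomb β w′ ⟩
          ≈⟨ +-congˡ (-‿cong (⟨⟩-lincombʳ (v′ s) β w′)) ⟩
        β s - ΣF k (λ t → β t * ⟨ v′ s , w′ t ⟩)
          ≈⟨ +-congˡ (-‿cong (ΣF-cong k (λ t → *-congˡ (trans (dual′ s t) (reflexive (idM-sym s t)))))) ⟩
        β s - ΣF k (λ t → β t * idM t s)
          ≈⟨ +-congˡ (-‿cong (ΣF-idMʳ k s β)) ⟩
        β s - β s
          ≈⟨ -‿inverseʳ _ ⟩
        0# ∎

      ⟨v₀,w₀⟩≈1 : ⟨ v zero , w₀ ⟩ ≈ 1#
      ⟨v₀,w₀⟩≈1 = begin
        ⟨ v zero , w₀ ⟩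
          ≈⟨ ⟨⟩-subʳ (v zero) e _ ⟩
        ⟨ v zero , e ⟩ - ⟨ v zero , lincomb β w′ ⟩
          ≈⟨ +-congˡ (-‿cong (⟨⟩-lincombʳ (v zero) β w′)) ⟩
        ⟨ v zero , e ⟩ - ΣF k (λ t → β t * α t)
          ≈⟨ +-congˡ (-‿cong (ΣF-cong k (λ t → *-comm _ _))) ⟩
        ⟨ v zero , e ⟩ - ΣF k (λ t → α t * β t)
          ≈⟨ +-congˡ (-‿cong (⟨⟩-lincombˡ α v′ e)) ⟨
        ⟨ v zero , e ⟩ - ⟨ lincomb α v′ , e ⟩
          ≈⟨ ⟨⟩-subˡ (v zero) _ e ⟨
        ⟨ u , e ⟩
          ≈⟨ ⟨u,e⟩≈1 ⟩
        1# ∎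

      dual : ∀ s t → ⟨ v s , w t ⟩ ≈ idM s t
      dual zero    zero    = ⟨v₀,w₀⟩≈1
      dual (suc s) zero    = ⟨v′,w₀⟩≈0 s
      dual zero    (suc t) = begin
        ⟨ v zero , w (suc t) ⟩
          ≈⟨ ⟨⟩-subʳ (v zero) (w′ t) _ ⟩
        α t - ⟨ v zero , α t ∙M w₀ ⟩
          ≈⟨ +-congˡ (-‿cong (⟨⟩-∙ʳ (α t) (v zero) w₀)) ⟩
        α t - α t * ⟨ v zero , w₀ ⟩
          ≈⟨ +-congˡ (-‿cong (trans (*-congˡ ⟨v₀,w₀⟩≈1) (*-identityʳ _))) ⟩
        α t - α t
          ≈⟨ -‿inverseʳ _ ⟩
        0# ∎
      dual (suc s) (suc t) = begin
        ⟨ v′ s , w (suc t) ⟩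
          ≈⟨ ⟨⟩-subʳ (v′ s) (w′ t) _ ⟩
        ⟨ v′ s , w′ t ⟩ - ⟨ v′ s , α t ∙M w₀ ⟩
          ≈⟨ +-cong (dual′ s t) (-‿cong (⟨⟩-∙ʳ (α t) (v′ s) w₀)) ⟩
        idM s t - α t * ⟨ v′ s , w₀ ⟩
          ≈⟨ +-congˡ (-‿cong (trans (*-congˡ (⟨v′,w₀⟩≈0 s)) (zeroʳ _))) ⟩
        idM s t - 0#
          ≈⟨ trans (+-congˡ -0#≈0#) (+-identityʳ _) ⟩
        idM s t ∎

module QuotientFamily {c ℓ} (F : CommutativeRing c ℓ) (isDiscreteField : IsDiscreteField F)
  {n : ℕ} (A B : Over.Mat F n) (AB≋I : Matrices._≋_ F (Matrices._·M_ F A B) (Matrices.idM F))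
  (d : ℕ) (m : Over.PS F) (minimalPolynomial : Over.IsMinPoly F A d m) where
  open CommutativeRing F hiding (zero)
  open IsDiscreteField isDiscreteField
  open Over F using (PS; _≈ₚ_; evalM; DegLt)
  open Matrices F
  open Evaluation F A
  open TraceForm F
  open DualFamilies F isDiscreteField
  open Σ minimalPolynomial renaming (proj₁ to m-monic; proj₂ to m-annihilating)
  open Quotient F A d m (proj₂ m-monic) (proj₁ m-annihilating) public

  annihilator-degree : ∀ e (p : PS) → ¬ (p e ≈ 0#) → DegLt (suc e) p → evalM e p A ≋ zeroM → d ≤ e
  annihilator-degree e p pₑ≉0 p-degree p[A]≋0 = proj₂ m-annihilating e (λ s → y * p s)
    ( trans (*-comm _ _) pₑy≈1 , (λ s e<s → trans (*-congˡ (p-degree s e<s)) (zeroʳ y)) )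
    (≋-trans (evalM-∙ e y p) (∙-zeroʳ y p[A]≋0))
    where
      y = proj₁ (inverse (p e) pₑ≉0)
      pₑy≈1 = proj₂ (inverse (p e) pₑ≉0)

  quotientFamily : Fin d → Mat n
  quotientFamily t = horner (suc (toℕ t)) ·M A

  quotientPolynomial : (Fin d → Carrier) → PS
  quotientPolynomial cs s = ΣF d (λ t → cs t * m (suc (toℕ t +ℕ s)))

  -- quotientPolynomial cs = Σ cₜ (m(x) - m₀ - ... - mₜ xᵗ) / xᵗ⁺¹; as m is monic of degree d,
  -- if t₀ is the first index with cₜ₀ ≠ 0 then it has degree d - 1 - t₀ and leading coefficient cₜ₀.
  module LeadingTerm (cs : Fin d → Carrier) (t₀ : Fin d)
                     (earlier≈0 : ∀ t → toℕ t < toℕ t₀ → cs t ≈ 0#) where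
    T : ℕ
    T = toℕ t₀

    E : ℕ
    E = proj₁ (ℕ.m≤n⇒∃[o]m+o≡n (Fin.toℕ<n t₀))

    d≡ : suc T +ℕ E ≡ d
    d≡ = proj₂ (ℕ.m≤n⇒∃[o]m+o≡n (Fin.toℕ<n t₀))

    private
      before : ∀ t s → toℕ t < T → cs t * m (suc (toℕ t +ℕ s)) ≈ 0#
      before t s t<T = trans (*-congʳ (earlier≈0 t t<T)) (zeroˡ _)

      beyond : ∀ t s → T +ℕ E < toℕ t +ℕ s → cs t * m (suc (toℕ t +ℕ s)) ≈ 0#
      beyond t s lt =
        trans (*-congˡ (proj₂ m-monic _ (≡.subst (_< suc (toℕ t +ℕ s)) d≡ (s≤s lt)))) (zeroʳ _)

    leading : quotientPolynomial cs E ≈ cs t₀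
    leading = begin
      quotientPolynomial cs E    ≈⟨ ΣF-single d t₀ _ others≈0 ⟩
      cs t₀ * m (suc (T +ℕ E))   ≈⟨ *-congˡ (trans (reflexive (cong m d≡)) (proj₁ m-monic)) ⟩
      cs t₀ * 1#                 ≈⟨ *-identityʳ _ ⟩
      cs t₀                      ∎
      where
        open import Relation.Binary.Reasoning.Setoid setoid
        others≈0 : ∀ t → t ≢ t₀ → cs t * m (suc (toℕ t +ℕ E)) ≈ 0#
        others≈0 t t≢t₀ with ℕ.<-cmp (toℕ t) T
        ... | tri< t<T _ _ = before t E t<T
        ... | tri≈ _ t≡T _ = ⊥-elim (t≢t₀ (Fin.toℕ-injective t≡T))
        ... | tri> _ _ T<t = beyond t E (ℕ.+-monoˡ-< E T<t)

    degree : DegLt (suc E) (quotientPolynomial cs)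
    degree s E<s = ΣF-zero d vanishes
      where
        vanishes : ∀ t → cs t * m (suc (toℕ t +ℕ s)) ≈ 0#
        vanishes t with toℕ t ℕ.<? T
        ... | yes t<T = before t s t<T
        ... | no  t≮T = beyond t s (ℕ.+-mono-≤-< (ℕ.≮⇒≥ t≮T) E<s)

  quotientFamily-independent : Independent quotientFamily
  quotientFamily-independent cs Σ≋0 with Fin.all? (λ t → cs t ≟F 0#)
  ... | yes cs≈0 = cs≈0
  ... | no  cs≉0 with t₀ , cₜ₀≉0 , earlier≈0 ← Fin.¬∀⟶∃¬-smallest d _ (λ t → cs t ≟F 0#) cs≉0 =
    ⊥-elim (ℕ.<-irrefl ≡.refl (ℕ.<-≤-trans E<d (annihilator-degree E p pₑ≉0 degree p[A]≋0)))
    where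
      below≈0 : ∀ t → toℕ t < toℕ t₀ → cs t ≈ 0#
      below≈0 t t<t₀ = ≡.subst (λ u → cs u ≈ 0#)
        (Fin.toℕ-injective (≡.trans (Fin.toℕ-inject (fromℕ< t<t₀)) (Fin.toℕ-fromℕ< t<t₀)))
        (earlier≈0 (fromℕ< t<t₀))
      open LeadingTerm cs t₀ below≈0
      p : PS
      p = quotientPolynomial cs
      E<d : E < d
      E<d = ℕ.≤-trans (s≤s (ℕ.m≤n+m E T)) (ℕ.≤-reflexive d≡)
      pₑ≉0 : ¬ (p E ≈ 0#)
      pₑ≉0 pₑ≈0 = cₜ₀≉0 (trans (sym leading) pₑ≈0)
      p[A]≋0 : evalM E p A ≋ zeroM
      p[A]≋0 = begin
        evalM E p A
          ≈⟨ evalM-extend E (suc T) p degree ⟨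
        evalM (suc T +ℕ E) p A
          ≡⟨ cong (λ e → evalM e p A) d≡ ⟩
        evalM d p A
          ≈⟨ evalM-lincomb d cs (λ t s → m (suc (toℕ t +ℕ s))) ⟩
        lincomb cs (λ t → horner (suc (toℕ t)))
          ≈⟨ ·-cancelʳ AB≋I (≋-trans (·-distribʳ-lincomb cs _ A) (≋-trans Σ≋0 (≋-sym (·-zeroˡ A)))) ⟩
        zeroM ∎
        where open ≋-Reasoning

  quotientTrace-surjective : ∀ a → DegLt d a → Σ (Mat n) λ A₁ → quotientTrace A₁ ≈ₚ a
  quotientTrace-surjective a a-degree = A₁ , A₁↦a
    where
      w : Fin d → Mat n
      w = proj₁ (dualFamily d quotientFamily quotientFamily-independent)
      dual : ∀ s t → ⟨ quotientFamily s , w t ⟩ ≈ idM s t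
      dual = proj₂ (dualFamily d quotientFamily quotientFamily-independent)
      A₁ : Mat n
      A₁ = lincomb (λ t → a (toℕ t)) w
      A₁↦a-below : ∀ s → quotientTrace A₁ (toℕ s) ≈ a (toℕ s)
      A₁↦a-below s = trans (⟨⟩-lincombʳ (quotientFamily s) _ w)
        (trans (ΣF-cong d (λ t → *-congˡ (trans (dual s t) (reflexive (idM-sym s t)))))
               (ΣF-idMʳ d s (λ t → a (toℕ t))))
      A₁↦a : quotientTrace A₁ ≈ₚ a
      A₁↦a t with t ℕ.<? d
      ... | yes t<d = ≡.subst (λ u → quotientTrace A₁ u ≈ a u) (Fin.toℕ-fromℕ< t<d)
                              (A₁↦a-below (fromℕ< t<d))
      ... | no  t≮d = trans (quotientTrace-degree A₁ t (ℕ.≮⇒≥ t≮d)) (sym (a-degree t (ℕ.≮⇒≥ t≮d)))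

IsFiniteField⇒IsDiscreteField : ∀ {c ℓ} {F : CommutativeRing c ℓ} {q} →
                                 Over.IsFiniteField F q → IsDiscreteField F
IsFiniteField⇒IsDiscreteField {F = F} 𝔽 = record { 1≉0 = 1≉0 ; inverse = inverse ; _≟F_ = _≟F_ }
  where
    open CommutativeRing F using (_≈_; trans; sym)
    open Over.IsFiniteField 𝔽
    _≟F_ : Decidable _≈_
    x ≟F y with i , eᵢ≈x ← enum-surj x with j , eⱼ≈y ← enum-surj y with i Fin.≟ j
    ... | yes ≡.refl = yes (trans (sym eᵢ≈x) eⱼ≈y)
    ... | no  i≢j    = no (λ x≈y → i≢j (enum-inj i j (trans eᵢ≈x (trans x≈y (sym eⱼ≈y)))))

theorem6p1 : ∀ {c ℓ} (F : CommutativeRing c ℓ) (q p k : ℕ) →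
    Over.IsFiniteField F q → Prime p → ¬ (2 ∣ p) → 1 ≤ k → q ≡ p ^ k →
    (n : ℕ) (A : Over.Mat F n) → Over.Invertible F A →
    (d : ℕ) (m : Over.PS F) → Over.IsMinPoly F A d m →
    (h : Over.PS F) → Over._≈ₚ_ F (Over._*ₚ_ F h m) (Over.char F A) →
    ((A₁ : Over.Mat F n) → ∃ λ a → Over.DegLt F d a ×
        Over._≈ₚ_ F (Over.∂char F A A₁) (Over._*ₚ_ F h a))
    × ((a : Over.PS F) → Over.DegLt F d a → ∃ λ A₁ →
        Over._≈ₚ_ F (Over.∂char F A A₁) (Over._*ₚ_ F h a))
theorem6p1 F _ _ _ 𝔽 _ _ _ _ _ A (B , AB≋I , BA≋I) d m minimalPolynomial h h*m≈char =
  (λ A₁ → quotientTrace A₁ , quotientTrace-degree A₁ , ∂char≈h*a A₁) ,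
  λ a a-degree → let A₁ , A₁↦a = quotientTrace-surjective a a-degree in
    A₁ , λ t → trans (∂char≈h*a A₁ t) (PowerSeries.*ₚ-congʳ F h A₁↦a t)
  where
    open CommutativeRing F using (trans)
    open QuotientFamily F (IsFiniteField⇒IsDiscreteField 𝔽) A B AB≋I d m minimalPolynomial
    ∂char≈h*a : ∀ A₁ → Over._≈ₚ_ F (Over.∂char F A A₁) (Over._*ₚ_ F h (quotientTrace A₁))
    ∂char≈h*a = ∂char≈h*quotientTrace BA≋I h h*m≈char
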